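{- Let $C$ be an $(X,s)$-neighbour transitive code in $H(m,q)$. Then $C$ is $s$-regular. Furthermore, if $\mathbf{0}\in C$ and the minimum distance satisfies $\delta\ge2s$, then for each $k\le m$ the set of codewords of weight $k$ forms a $q$-ary $s$-$(m,k,\lambda)$ design, for some $\lambda$.
   Context: The Hamming graph $H(m,q)$ has vertices the $m$-tuples over an alphabet $Q$ ($|Q|=q\ge2$, with distinguished element $0$), adjacent iff differing in one entry; $\Gamma_k(\nu)$ is the set of vertices at distance $k$ from $\nu$; $\mathbf{0}=(0,\dots,0)$; the weight of a vertex is its number of non-zero entries. For a code $C$, $\delta$ is its minimum distance, $\rho$ its covering radius, $C_i$ the set of vertices at distance exactly $i$ from $C$, $\mathrm{Aut}(C)$ its setwise stabiliser in $\mathrm{Aut}(H(m,q))$. For $X\le\mathrm{Aut}(C)$, $C$ is $(X,s)$-neighbour transitive if $X$ is transitive on each of $C,C_1,\dots,C_s$. $C$ is $s$-regular ($0\le s\le\rho$) if for each $0\le i\le s$, each $\nu\in C_i$, each $0\le k\le m$, $|\Gamma_k(\nu)\cap C|$ depends only on $i,k$. A vertex $\nu$ is covered by $\alpha$ if $\nu_i=\alpha_i$ for every entry $i$ with $\nu_i\ne0$. A $q$-ary $s$-$(v,k,\lambda)$ design (with $v=m$, $k\ge s$) is a subset $\mathcal{D}$ of the weight-$k$ vertices such that every weight-$s$ vertex is covered by exactly $\lambda$ elements of $\mathcal{D}$ (the empty set is allowed, with $\lambda=0$). -}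

module Defs where

open import Data.Nat using (ℕ; zero; suc; s≤s; z≤n; _+_; _*_; _≤_; _<_; _≡ᵇ_)
open import Data.Nat.Properties using (≤-trans)
open import Data.Fin as Fin using (Fin; toℕ; fromℕ<)
open import Data.Fin.Permutation using (Permutation′; _⟨$⟩ʳ_; _⟨$⟩ˡ_)
open import Data.Vec using (Vec; []; _∷_; lookup; tabulate; replicate)
open import Data.List using (List; length; map; concatMap; [_]; allFin; filterᵇ)
open import Data.Bool using (Bool; true; false; if_then_else_; _∧_; _∨_)
open import Data.Product using (Σ; _×_; _,_; ∃)
open import Relation.Nullary using (¬_)
open import Relation.Nullary.Decidable using (⌊_⌋)
open import Relation.Binary.PropositionalEquality using (_≡_; _≢_)

-- Vertices of H(m,q): m-tuples over the alphabet Q = Fin q;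
-- the distinguished element 0 of Q is the element with toℕ = 0.
Vertex : ℕ → ℕ → Set
Vertex m q = Vec (Fin q) m

zeroV : ∀ {q} (m : ℕ) → 2 ≤ q → Vertex m q
zeroV m q≥2 = replicate m (fromℕ< (≤-trans (s≤s z≤n) q≥2))

-- Hamming distance = graph distance in H(m,q): number of differing entries
dist : ∀ {m q} → Vertex m q → Vertex m q → ℕ
dist [] [] = 0
dist (a ∷ u) (b ∷ v) = (if ⌊ a Fin.≟ b ⌋ then 0 else 1) + dist u v

weight : ∀ {m q} → Vertex m q → ℕ
weight [] = 0
weight (a ∷ u) = (if toℕ a ≡ᵇ 0 then 0 else 1) + weight u

allVertices : ∀ m q → List (Vertex m q)
allVertices zero q = [ [] ]
allVertices (suc m) q = concatMap (λ a → map (a ∷_) (allVertices m q)) (allFin q)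

Code : ℕ → ℕ → Set
Code m q = Vertex m q → Bool

card : ∀ {m q} → (Vertex m q → Bool) → ℕ
card {m} {q} P = length (filterᵇ P (allVertices m q))

countΓ : ∀ {m q} → Code m q → Vertex m q → ℕ → ℕ
countΓ C ν k = card (λ α → (dist ν α ≡ᵇ k) ∧ C α)

InC : ∀ {m q} → Code m q → ℕ → Vertex m q → Set
InC C i ν = (Σ _ λ α → C α ≡ true × dist ν α ≡ i)
          × (∀ α → C α ≡ true → i ≤ dist ν α)

-- s ≤ ρ (covering radius): C nonempty and some vertex has distance ≥ s from C
CovRadiusAtLeast : ∀ {m q} → Code m q → ℕ → Set
CovRadiusAtLeast C s = (Σ _ λ α → C α ≡ true)
                     × (Σ _ λ ν → ∀ α → C α ≡ true → s ≤ dist ν α)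

-- Aut(H(m,q)) = S_q wr S_m : (h_1..h_m ; σ) acting by (ν^x)_i = h_i(ν_{σ⁻¹ i})
Aut : ℕ → ℕ → Set
Aut m q = (Fin m → Permutation′ q) × Permutation′ m

act : ∀ {m q} → Aut m q → Vertex m q → Vertex m q
act (h , σ) ν = tabulate (λ i → h i ⟨$⟩ʳ lookup ν (σ ⟨$⟩ˡ i))

-- X is a subgroup of Aut(H(m,q)) (elements compared via their action on vertices)
IsSubgroup : ∀ {m q} → (Aut m q → Set) → Set
IsSubgroup {m} {q} X =
    (Σ _ λ e → X e × (∀ ν → act e ν ≡ ν))
  × (∀ x y → X x → X y → Σ _ λ z → X z × (∀ ν → act z ν ≡ act y (act x ν)))
  × (∀ x → X x → Σ _ λ z → X z × (∀ ν → act z (act x ν) ≡ ν))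

Stabilises : ∀ {m q} → Code m q → Aut m q → Set
Stabilises C x = ∀ ν → C (act x ν) ≡ C ν

TransitiveOn : ∀ {m q} → (Aut m q → Set) → (Vertex m q → Set) → Set
TransitiveOn X S = ∀ ν ν' → S ν → S ν' → Σ _ λ x → X x × act x ν ≡ ν'

NeighbourTransitive : ∀ {m q} → Code m q → (Aut m q → Set) → ℕ → Set
NeighbourTransitive C X s =
  CovRadiusAtLeast C s × (∀ i → i ≤ s → TransitiveOn X (InC C i))

SRegular : ∀ {m q} → Code m q → ℕ → Set
SRegular {m} C s =
  CovRadiusAtLeast C s ×
  (∀ i → i ≤ s → ∀ ν ν' → InC C i ν → InC C i ν' →
     ∀ k → k ≤ m → countΓ C ν k ≡ countΓ C ν' k)

MinDistAtLeast : ∀ {m q} → Code m q → ℕ → Set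
MinDistAtLeast C d = ∀ α β → C α ≡ true → C β ≡ true → α ≢ β → d ≤ dist α β

coversᵇ : ∀ {m q} → Vertex m q → Vertex m q → Bool
coversᵇ [] [] = true
coversᵇ (a ∷ α) (b ∷ ν) = ((toℕ b ≡ᵇ 0) ∨ ⌊ b Fin.≟ a ⌋) ∧ coversᵇ α ν

IsDesign : ∀ {m q} → ℕ → ℕ → ℕ → (Vertex m q → Bool) → Set
IsDesign s k λ' D =
  s ≤ k × (∀ α → D α ≡ true → weight α ≡ k)
  × (∀ u → weight u ≡ s → card (λ α → D α ∧ coversᵇ α u) ≡ λ')

weightSlice : ∀ {m q} → Code m q → ℕ → (Vertex m q → Bool)
weightSlice C k α = C α ∧ (weight α ≡ᵇ k)

module Submission where

-- Part 1: automorphisms of H(m,q) are isometries, so an element of X sending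
-- ν ∈ C_i to ν′ ∈ C_i maps Γ_k(ν) ∩ C bijectively onto Γ_k(ν′) ∩ C.
--
-- Part 2: as 𝟎 ∈ C and δ ≥ 2s, a vertex of weight t ≤ s lies in C_t, so by
-- Part 1 the counts |Γ_d(v) ∩ C| depend only on the weight of v (≤ s).  Let
-- λ_w(v) be the number of weight-w codewords covering v.  By strong induction
-- on w, λ_w(v) depends only on weight v: the codewords at distance w - weight v
-- from v have weight ≤ w, those of weight exactly w being the ones covering v,
-- and the lighter slices contribute equally for v and v′.  For the latter, an
-- isometry fixing 𝟎 maps v′ to v, and for a constant-weight set the counts at
-- each distance from v are determined, by downward induction over vertices
-- supported on supp v, by its cover counts on those vertices (of weight ≤ t).

open import Defs
open import Data.Nat using (ℕ; _≤_; _*_)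
open import Data.Bool using (true)
open import Data.Product using (_×_; Σ)
open import Relation.Binary.PropositionalEquality using (_≡_)

open import Data.Nat using (zero; suc; _+_; _∸_; _<_; _≡ᵇ_; _<ᵇ_; s≤s; z≤n; _≤?_) renaming (_≟_ to _ℕ≟_)
open import Data.Nat.Properties
open import Data.Nat.Induction using (<-rec)
open import Algebra.Properties.CommutativeSemigroup +-commutativeSemigroup using (interchange; x∙yz≈y∙xz)
open import Data.Bool using (Bool; false; if_then_else_; _∧_; _∨_; not; T?)
open import Data.Bool.Properties using (T-≡; ∧-zeroʳ; ∧-identityʳ)
open import Data.List using (List; []; _∷_; length; map; concatMap; allFin; filterᵇ; _++_; tabulate)
open import Data.List.Properties using (map-tabulate)
open import Data.Fin as Fin using (Fin; toℕ)
open import Data.Fin.Permutation as Perm using (Permutation′; _⟨$⟩ʳ_; _⟨$⟩ˡ_; inverseˡ; inverseʳ)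
open import Data.Vec using ([]; _∷_; lookup; replicate)
open import Data.Vec.Properties using (lookup∘tabulate; ∷-injective; ∷-injectiveʳ; ≡-dec)
open import Data.Product using (_,_; proj₁)
open import Relation.Nullary using (¬_; Dec; yes; no)
open import Relation.Nullary.Decidable using (⌊_⌋; isYes≗does; dec-true; dec-false; ⌊⌋-map′)
open import Relation.Binary.Definitions using (DecidableEquality)
open import Relation.Binary.PropositionalEquality using (_≢_; refl; sym; trans; cong; cong₂; subst; subst₂; module ≡-Reasoning)
open import Data.Empty using (⊥-elim)
open import Function using (_∘_; id; Equivalence)

open ≡-Reasoning

private
  variable
    A B : Set

𝟙 : Bool → ℕ
𝟙 true  = 1
𝟙 false = 0

𝟙-∧ : ∀ a b → 𝟙 (a ∧ b) ≡ 𝟙 a * 𝟙 b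
𝟙-∧ true  b = sym (+-identityʳ (𝟙 b))
𝟙-∧ false b = refl

𝟙-split : ∀ c n → n ≡ 𝟙 c * n + 𝟙 (not c) * n
𝟙-split true  n = sym (trans (+-identityʳ (n + 0)) (+-identityʳ n))
𝟙-split false n = sym (+-identityʳ n)

⌊⌋-yes : ∀ {P : Set} (d : Dec P) → P → ⌊ d ⌋ ≡ true
⌊⌋-yes d p = trans (isYes≗does d) (dec-true d p)

⌊⌋-no : ∀ {P : Set} (d : Dec P) → ¬ P → ⌊ d ⌋ ≡ false
⌊⌋-no d ¬p = trans (isYes≗does d) (dec-false d ¬p)

≡ᵇ≡⌊≟⌋ : ∀ x y → (x ≡ᵇ y) ≡ ⌊ x ℕ≟ y ⌋
≡ᵇ≡⌊≟⌋ x y = sym (trans (⌊⌋-map′ _ _ (T? (x ≡ᵇ y))) (isYes-T? (x ≡ᵇ y)))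
  where
  isYes-T? : ∀ b → ⌊ T? b ⌋ ≡ b
  isYes-T? true  = refl
  isYes-T? false = refl

≡ᵇ-sound : ∀ {x y} → (x ≡ᵇ y) ≡ true → x ≡ y
≡ᵇ-sound {x} {y} e = ≡ᵇ⇒≡ x y (Equivalence.from T-≡ e)

≡ᵇ-complete : ∀ {x y} → x ≡ y → (x ≡ᵇ y) ≡ true
≡ᵇ-complete {x} {y} x≡y = trans (≡ᵇ≡⌊≟⌋ x y) (⌊⌋-yes (x ℕ≟ y) x≡y)

≡ᵇ-false : ∀ {x y} → x ≢ y → (x ≡ᵇ y) ≡ false
≡ᵇ-false {x} {y} x≢y = trans (≡ᵇ≡⌊≟⌋ x y) (⌊⌋-no (x ℕ≟ y) x≢y)

≡ᵇ-⇔ : ∀ {a b c d} → (a ≡ b → c ≡ d) → (c ≡ d → a ≡ b) → (a ≡ᵇ b) ≡ (c ≡ᵇ d)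
≡ᵇ-⇔ {a} {b} {c} {d} to from with a ℕ≟ b
... | yes a≡b = trans (≡ᵇ-complete a≡b) (sym (≡ᵇ-complete (to a≡b)))
... | no  a≢b = trans (≡ᵇ-false a≢b) (sym (≡ᵇ-false (a≢b ∘ from)))

∑ : List A → (A → ℕ) → ℕ
∑ []       h = 0
∑ (x ∷ xs) h = h x + ∑ xs h

∑-cong : ∀ (L : List A) {h k : A → ℕ} → (∀ x → h x ≡ k x) → ∑ L h ≡ ∑ L k
∑-cong []      h≡k = refl
∑-cong (x ∷ L) h≡k = cong₂ _+_ (h≡k x) (∑-cong L h≡k)

∑-zero : ∀ (L : List A) → ∑ L (λ _ → 0) ≡ 0
∑-zero []      = refl
∑-zero (x ∷ L) = ∑-zero L

∑-+ : ∀ (L : List A) (h k : A → ℕ) → ∑ L (λ x → h x + k x) ≡ ∑ L h + ∑ L k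
∑-+ []      h k = refl
∑-+ (x ∷ L) h k = trans (cong (h x + k x +_) (∑-+ L h k)) (interchange (h x) (k x) (∑ L h) (∑ L k))

∑-*ʳ : ∀ (L : List A) (h : A → ℕ) c → ∑ L (λ x → h x * c) ≡ ∑ L h * c
∑-*ʳ []      h c = refl
∑-*ʳ (x ∷ L) h c = trans (cong (h x * c +_) (∑-*ʳ L h c)) (sym (*-distribʳ-+ c (h x) (∑ L h)))

∑-*ˡ : ∀ (L : List A) (h : A → ℕ) c → ∑ L (λ x → c * h x) ≡ c * ∑ L h
∑-*ˡ L h c = begin
  ∑ L (λ x → c * h x) ≡⟨ ∑-cong L (λ x → *-comm c (h x)) ⟩
  ∑ L (λ x → h x * c) ≡⟨ ∑-*ʳ L h c ⟩
  ∑ L h * c           ≡⟨ *-comm (∑ L h) c ⟩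
  c * ∑ L h           ∎

∑-swap : ∀ (L : List A) (M : List B) (F : A → B → ℕ)
       → ∑ L (λ a → ∑ M (F a)) ≡ ∑ M (λ b → ∑ L (λ a → F a b))
∑-swap []      M F = sym (∑-zero M)
∑-swap (a ∷ L) M F = trans (cong (∑ M (F a) +_) (∑-swap L M F))
                           (sym (∑-+ M (F a) (λ b → ∑ L (λ a′ → F a′ b))))

∑-++ : ∀ (L M : List A) (h : A → ℕ) → ∑ (L ++ M) h ≡ ∑ L h + ∑ M h
∑-++ []      M h = refl
∑-++ (x ∷ L) M h = trans (cong (h x +_) (∑-++ L M h)) (sym (+-assoc (h x) (∑ L h) (∑ M h)))

∑-map : ∀ (L : List B) (f : B → A) (h : A → ℕ) → ∑ (map f L) h ≡ ∑ L (h ∘ f)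
∑-map []      f h = refl
∑-map (x ∷ L) f h = cong (h (f x) +_) (∑-map L f h)

∑-concatMap : ∀ (L : List B) (f : B → List A) (h : A → ℕ)
            → ∑ (concatMap f L) h ≡ ∑ L (λ b → ∑ (f b) h)
∑-concatMap []      f h = refl
∑-concatMap (x ∷ L) f h = trans (∑-++ (f x) (concatMap f L) h) (cong (∑ (f x) h +_) (∑-concatMap L f h))

length-filter≡∑ : ∀ (P : A → Bool) (L : List A) → length (filterᵇ P L) ≡ ∑ L (𝟙 ∘ P)
length-filter≡∑ P []      = refl
length-filter≡∑ P (x ∷ L) with P x
... | true  = cong suc (length-filter≡∑ P L)
... | false = length-filter≡∑ P L

-- Sums over a list enumerating a type with decidable equality

module Enumerated (_≟_ : DecidableEquality A) (L : List A)
                  (once : ∀ a → ∑ L (λ b → 𝟙 ⌊ b ≟ a ⌋) ≡ 1) where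

  δ : A → A → ℕ
  δ b a = 𝟙 ⌊ b ≟ a ⌋

  δ-subst : ∀ a b (h : A → ℕ) → δ b a * h b ≡ δ b a * h a
  δ-subst a b h with b ≟ a
  ... | yes refl = refl
  ... | no _     = refl

  ∑-δ : ∀ a (h : A → ℕ) → ∑ L (λ b → δ b a * h b) ≡ h a
  ∑-δ a h = begin
    ∑ L (λ b → δ b a * h b) ≡⟨ ∑-cong L (λ b → δ-subst a b h) ⟩
    ∑ L (λ b → δ b a * h a) ≡⟨ ∑-*ʳ L (λ b → δ b a) (h a) ⟩
    ∑ L (λ b → δ b a) * h a ≡⟨ cong (_* h a) (once a) ⟩
    1 * h a                 ≡⟨ *-identityˡ (h a) ⟩
    h a                     ∎

  ∑-reindex : ∀ (f g : A → A) → (∀ a → g (f a) ≡ a) → (∀ b → f (g b) ≡ b)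
            → ∀ (h : A → ℕ) → ∑ L (h ∘ f) ≡ ∑ L h
  ∑-reindex f g gf fg h = begin
    ∑ L (h ∘ f)                                  ≡⟨ ∑-cong L (λ a → sym (∑-δ (f a) h)) ⟩
    ∑ L (λ a → ∑ L (λ b → δ b (f a) * h b))      ≡⟨ ∑-swap L L _ ⟩
    ∑ L (λ b → ∑ L (λ a → δ b (f a) * h b))      ≡⟨ ∑-cong L (λ b → ∑-*ʳ L (λ a → δ b (f a)) (h b)) ⟩
    ∑ L (λ b → ∑ L (λ a → δ b (f a)) * h b)      ≡⟨ ∑-cong L (λ b → cong (_* h b) (trans (∑-cong L (δ-transpose b)) (once (g b)))) ⟩
    ∑ L (λ b → 1 * h b)                          ≡⟨ ∑-cong L (λ b → *-identityˡ (h b)) ⟩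
    ∑ L h                                        ∎
    where
    δ-transpose : ∀ b a → δ b (f a) ≡ δ a (g b)
    δ-transpose b a with b ≟ f a | a ≟ g b
    ... | yes _    | yes _    = refl
    ... | no _     | no _     = refl
    ... | yes refl | no a≢gb  = ⊥-elim (a≢gb (sym (gf a)))
    ... | no b≢fa  | yes refl = ⊥-elim (b≢fa (sym (fg b)))

  ∑-fibres : ∀ (p : A → A) (G H : A → ℕ)
           → ∑ L (λ a → G a * H (p a)) ≡ ∑ L (λ r → H r * ∑ L (λ a → δ r (p a) * G a))
  ∑-fibres p G H = begin
    ∑ L (λ a → G a * H (p a))                        ≡⟨ ∑-cong L (λ a → sym (∑-δ (p a) (λ r → G a * H r))) ⟩
    ∑ L (λ a → ∑ L (λ r → δ r (p a) * (G a * H r)))  ≡⟨ ∑-swap L L _ ⟩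
    ∑ L (λ r → ∑ L (λ a → δ r (p a) * (G a * H r)))  ≡⟨ ∑-cong L (λ r → ∑-cong L (λ a → rearrange (δ r (p a)) (G a) (H r))) ⟩
    ∑ L (λ r → ∑ L (λ a → H r * (δ r (p a) * G a)))  ≡⟨ ∑-cong L (λ r → ∑-*ˡ L (λ a → δ r (p a) * G a) (H r)) ⟩
    ∑ L (λ r → H r * ∑ L (λ a → δ r (p a) * G a))    ∎
    where
    rearrange : ∀ x y z → x * (y * z) ≡ z * (x * y)
    rearrange x y z = trans (sym (*-assoc x y z)) (*-comm (x * y) z)

  ∑-pin : ∀ a (h k : A → ℕ) → ∑ L h ≡ ∑ L k → (∀ b → b ≢ a → h b ≡ k b) → h a ≡ k a
  ∑-pin a h k ∑h≡∑k off = +-cancelʳ-≡ (rest h) (h a) (k a) (begin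
    h a + rest h ≡⟨ sym (split h) ⟩
    ∑ L h        ≡⟨ ∑h≡∑k ⟩
    ∑ L k        ≡⟨ split k ⟩
    k a + rest k ≡⟨ cong (k a +_) (sym rest-agree) ⟩
    k a + rest h ∎)
    where
    rest : (A → ℕ) → ℕ
    rest l = ∑ L (λ b → 𝟙 (not ⌊ b ≟ a ⌋) * l b)
    split : ∀ l → ∑ L l ≡ l a + rest l
    split l = begin
      ∑ L l                                                    ≡⟨ ∑-cong L (λ b → 𝟙-split ⌊ b ≟ a ⌋ (l b)) ⟩
      ∑ L (λ b → δ b a * l b + 𝟙 (not ⌊ b ≟ a ⌋) * l b)        ≡⟨ ∑-+ L _ _ ⟩
      ∑ L (λ b → δ b a * l b) + rest l                         ≡⟨ cong (_+ rest l) (∑-δ a l) ⟩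
      l a + rest l                                             ∎
    rest-agree : rest h ≡ rest k
    rest-agree = ∑-cong L term
      where
      term : ∀ b → 𝟙 (not ⌊ b ≟ a ⌋) * h b ≡ 𝟙 (not ⌊ b ≟ a ⌋) * k b
      term b with b ≟ a
      ... | yes _   = refl
      ... | no b≢a  = cong (_+ 0) (off b b≢a)

∑-allFin-suc : ∀ n (h : Fin (suc n) → ℕ) → ∑ (allFin (suc n)) h ≡ h Fin.zero + ∑ (allFin n) (h ∘ Fin.suc)
∑-allFin-suc n h = cong (h Fin.zero +_) (begin
  ∑ (tabulate Fin.suc) h       ≡⟨ cong (λ L → ∑ L h) (sym (map-tabulate id Fin.suc)) ⟩
  ∑ (map Fin.suc (allFin n)) h ≡⟨ ∑-map (allFin n) Fin.suc h ⟩
  ∑ (allFin n) (h ∘ Fin.suc)   ∎)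

allFin-once : ∀ {n} (a : Fin n) → ∑ (allFin n) (λ b → 𝟙 ⌊ b Fin.≟ a ⌋) ≡ 1
allFin-once {suc n} Fin.zero    =
  trans (∑-allFin-suc n (λ b → 𝟙 ⌊ b Fin.≟ Fin.zero ⌋)) (cong suc (∑-zero (allFin n)))
allFin-once {suc n} (Fin.suc a) = begin
  ∑ (allFin (suc n)) (λ b → 𝟙 ⌊ b Fin.≟ Fin.suc a ⌋)  ≡⟨ ∑-allFin-suc n (λ b → 𝟙 ⌊ b Fin.≟ Fin.suc a ⌋) ⟩
  ∑ (allFin n) (λ b → 𝟙 ⌊ Fin.suc b Fin.≟ Fin.suc a ⌋) ≡⟨ ∑-cong (allFin n) (λ b → cong 𝟙 (⌊⌋-map′ _ _ (b Fin.≟ a))) ⟩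
  ∑ (allFin n) (λ b → 𝟙 ⌊ b Fin.≟ a ⌋)                ≡⟨ allFin-once a ⟩
  1                                                   ∎

module FinSum {n : ℕ} = Enumerated (Fin._≟_ {n}) (allFin n) allFin-once

_≟ᵛ_ : ∀ {m q} → DecidableEquality (Vertex m q)
_≟ᵛ_ = ≡-dec Fin._≟_

∑-allVertices-suc : ∀ m q (h : Vertex (suc m) q → ℕ)
  → ∑ (allVertices (suc m) q) h ≡ ∑ (allFin q) (λ c → ∑ (allVertices m q) (λ v → h (c ∷ v)))
∑-allVertices-suc m q h =
  trans (∑-concatMap (allFin q) (λ c → map (c ∷_) (allVertices m q)) h)
        (∑-cong (allFin q) (λ c → ∑-map (allVertices m q) (c ∷_) h))

𝟙≟ᵛ-∷ : ∀ {m q} (c x : Fin q) (v a : Vertex m q)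
  → 𝟙 ⌊ (c ∷ v) ≟ᵛ (x ∷ a) ⌋ ≡ 𝟙 ⌊ c Fin.≟ x ⌋ * 𝟙 ⌊ v ≟ᵛ a ⌋
𝟙≟ᵛ-∷ c x v a with c Fin.≟ x | v ≟ᵛ a
... | yes _ | yes _ = refl
... | yes _ | no _  = refl
... | no _  | _     = refl

allVertices-once : ∀ {m q} (a : Vertex m q) → ∑ (allVertices m q) (λ b → 𝟙 ⌊ b ≟ᵛ a ⌋) ≡ 1
allVertices-once {zero}      []      = refl
allVertices-once {suc m} {q} (x ∷ a) = begin
  ∑ (allVertices (suc m) q) (λ b → 𝟙 ⌊ b ≟ᵛ (x ∷ a) ⌋)
    ≡⟨ ∑-allVertices-suc m q (λ b → 𝟙 ⌊ b ≟ᵛ (x ∷ a) ⌋) ⟩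
  ∑ (allFin q) (λ c → ∑ (allVertices m q) (λ v → 𝟙 ⌊ (c ∷ v) ≟ᵛ (x ∷ a) ⌋))
    ≡⟨ ∑-cong (allFin q) (λ c → ∑-cong (allVertices m q) (λ v → 𝟙≟ᵛ-∷ c x v a)) ⟩
  ∑ (allFin q) (λ c → ∑ (allVertices m q) (λ v → 𝟙 ⌊ c Fin.≟ x ⌋ * 𝟙 ⌊ v ≟ᵛ a ⌋))
    ≡⟨ ∑-cong (allFin q) (λ c → trans (∑-*ˡ (allVertices m q) (λ v → 𝟙 ⌊ v ≟ᵛ a ⌋) (𝟙 ⌊ c Fin.≟ x ⌋))
                                         (cong (𝟙 ⌊ c Fin.≟ x ⌋ *_) (allVertices-once a))) ⟩
  ∑ (allFin q) (λ c → 𝟙 ⌊ c Fin.≟ x ⌋ * 1)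
    ≡⟨ trans (∑-*ʳ (allFin q) (λ c → 𝟙 ⌊ c Fin.≟ x ⌋) 1) (trans (*-identityʳ _) (allFin-once x)) ⟩
  1 ∎

module VertexSum {m q : ℕ} = Enumerated (_≟ᵛ_ {m} {q}) (allVertices m q) allVertices-once

card≡∑ : ∀ {m q} (P : Vertex m q → Bool) → card P ≡ ∑ (allVertices m q) (𝟙 ∘ P)
card≡∑ {m} {q} P = length-filter≡∑ P (allVertices m q)

card-cong : ∀ {m q} {P Q : Vertex m q → Bool} → (∀ a → P a ≡ Q a) → card P ≡ card Q
card-cong {m} {q} {P} {Q} P≡Q =
  trans (card≡∑ P) (trans (∑-cong (allVertices m q) (cong 𝟙 ∘ P≡Q)) (sym (card≡∑ Q)))

card-empty : ∀ {m q} (P : Vertex m q → Bool) → (∀ a → P a ≡ false) → card P ≡ 0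
card-empty {m} {q} P none = trans (card-cong none) (trans (card≡∑ {m} {q} (λ _ → false)) (∑-zero (allVertices m q)))

card-reindex : ∀ {m q} (f g : Vertex m q → Vertex m q) → (∀ a → g (f a) ≡ a) → (∀ b → f (g b) ≡ b)
  → (P : Vertex m q → Bool) → card (P ∘ f) ≡ card P
card-reindex f g gf fg P =
  trans (card≡∑ (P ∘ f)) (trans (VertexSum.∑-reindex f g gf fg (𝟙 ∘ P)) (sym (card≡∑ P)))

-- The Hamming metric, coordinate by coordinate

coordDist : ∀ {q} → Fin q → Fin q → ℕ
coordDist a b = if ⌊ a Fin.≟ b ⌋ then 0 else 1

coordDist-refl : ∀ {q} (a : Fin q) → coordDist a a ≡ 0
coordDist-refl a = cong (if_then 0 else 1) (⌊⌋-yes (a Fin.≟ a) refl)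

coordDist-injective : ∀ {q r} (f : Fin q → Fin r) → (∀ {a b} → f a ≡ f b → a ≡ b)
  → ∀ a b → coordDist (f a) (f b) ≡ coordDist a b
coordDist-injective f inj a b with a Fin.≟ b
... | yes refl = coordDist-refl (f a)
... | no  a≢b  = cong (if_then 0 else 1) (⌊⌋-no (f a Fin.≟ f b) (a≢b ∘ inj))

coordDist-sym : ∀ {q} (a b : Fin q) → coordDist a b ≡ coordDist b a
coordDist-sym a b with a Fin.≟ b
... | yes refl = sym (coordDist-refl a)
... | no  a≢b  = cong (if_then 0 else 1) (sym (⌊⌋-no (b Fin.≟ a) (a≢b ∘ sym)))

coordDist-triangle : ∀ {q} (a b c : Fin q) → coordDist a c ≤ coordDist a b + coordDist b c
coordDist-triangle a b c with a Fin.≟ b | b Fin.≟ c | a Fin.≟ c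
... | _        | _        | yes _   = z≤n
... | yes refl | yes refl | no a≢a  = ⊥-elim (a≢a refl)
... | yes _    | no _     | no _    = ≤-refl
... | no _     | yes _    | no _    = ≤-refl
... | no _     | no _     | no _    = s≤s z≤n

coordDist≡0 : ∀ {q} (a b : Fin q) → coordDist a b ≡ 0 → a ≡ b
coordDist≡0 a b e with a Fin.≟ b
... | yes a≡b = a≡b

dist-refl : ∀ {m q} (u : Vertex m q) → dist u u ≡ 0
dist-refl []      = refl
dist-refl (a ∷ u) = cong₂ _+_ (coordDist-refl a) (dist-refl u)

dist-sym : ∀ {m q} (u v : Vertex m q) → dist u v ≡ dist v u
dist-sym []      []      = refl
dist-sym (a ∷ u) (b ∷ v) = cong₂ _+_ (coordDist-sym a b) (dist-sym u v)

dist-triangle : ∀ {m q} (u v w : Vertex m q) → dist u w ≤ dist u v + dist v w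
dist-triangle []      []      []      = z≤n
dist-triangle (a ∷ u) (b ∷ v) (c ∷ w) =
  ≤-trans (+-mono-≤ (coordDist-triangle a b c) (dist-triangle u v w))
          (≤-reflexive (interchange (coordDist a b) (coordDist b c) (dist u v) (dist v w)))

dist≡0 : ∀ {m q} (u v : Vertex m q) → dist u v ≡ 0 → u ≡ v
dist≡0 []      []      _ = refl
dist≡0 (a ∷ u) (b ∷ v) e = cong₂ _∷_ (coordDist≡0 a b (m+n≡0⇒m≡0 (coordDist a b) e))
                                     (dist≡0 u v (m+n≡0⇒n≡0 (coordDist a b) e))

dist≡∑ : ∀ {m q} (u v : Vertex m q) → dist u v ≡ ∑ (allFin m) (λ i → coordDist (lookup u i) (lookup v i))
dist≡∑ []              []      = refl
dist≡∑ {suc m} (a ∷ u) (b ∷ v) = trans (cong (coordDist a b +_) (dist≡∑ u v))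
  (sym (∑-allFin-suc m (λ i → coordDist (lookup (a ∷ u) i) (lookup (b ∷ v) i))))

-- Weight and covering
--
-- From here on the alphabet is Fin (suc q), whose element zero is the
-- distinguished symbol 0.

zeroVec : ∀ {q} m → Vertex m (suc q)
zeroVec m = replicate m Fin.zero

nonzero : ∀ {q} → Fin q → ℕ
nonzero a = if toℕ a ≡ᵇ 0 then 0 else 1

nonzero≡coordDist : ∀ {q} (a : Fin (suc q)) → nonzero a ≡ coordDist Fin.zero a
nonzero≡coordDist Fin.zero    = refl
nonzero≡coordDist (Fin.suc a) = refl

weight≡dist : ∀ {m q} (u : Vertex m (suc q)) → weight u ≡ dist (zeroVec m) u
weight≡dist []      = refl
weight≡dist (a ∷ u) = cong₂ _+_ (nonzero≡coordDist a) (weight≡dist u)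

weight≤length : ∀ {m q} (u : Vertex m q) → weight u ≤ m
weight≤length []              = z≤n
weight≤length (Fin.zero ∷ u)  = m≤n⇒m≤1+n (weight≤length u)
weight≤length (Fin.suc a ∷ u) = s≤s (weight≤length u)

weight≡0 : ∀ {m q} (u : Vertex m (suc q)) → weight u ≡ 0 → u ≡ zeroVec m
weight≡0 {m} u w≡0 = sym (dist≡0 (zeroVec m) u (trans (sym (weight≡dist u)) w≡0))

weight-triangle : ∀ {m q} (v α : Vertex m (suc q)) → weight α ≤ weight v + dist v α
weight-triangle {m} v α =
  subst₂ _≤_ (sym (weight≡dist α)) (cong (_+ dist v α) (sym (weight≡dist v))) (dist-triangle (zeroVec m) v α)

nonzero≤1 : ∀ {q} (a : Fin q) → nonzero a ≤ 1
nonzero≤1 a with toℕ a ≡ᵇ 0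
... | true  = z≤n
... | false = ≤-refl

coordCovers : ∀ {q} → Fin q → Fin q → Bool
coordCovers b a = (toℕ b ≡ᵇ 0) ∨ ⌊ b Fin.≟ a ⌋

coordCovers-true : ∀ {q} (b a : Fin (suc q)) → coordCovers b a ≡ true → nonzero a ≡ nonzero b + coordDist b a
coordCovers-true Fin.zero    a _ = nonzero≡coordDist a
coordCovers-true (Fin.suc b) a e with Fin.suc b Fin.≟ a
... | yes refl = refl

coordCovers-false : ∀ {q} (b a : Fin (suc q)) → coordCovers b a ≡ false → nonzero a < nonzero b + coordDist b a
coordCovers-false (Fin.suc b) a e rewrite e = s≤s (nonzero≤1 a)

-- α covers v exactly when the triangle inequality through 𝟎 is an equality
covers⇒weight : ∀ {m q} (α v : Vertex m (suc q)) → coversᵇ α v ≡ true → weight α ≡ weight v + dist v α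
covers⇒weight []      []      _ = refl
covers⇒weight (a ∷ α) (b ∷ v) e with coordCovers b a in e₁ | e
... | true | e₂ = trans (cong₂ _+_ (coordCovers-true b a e₁) (covers⇒weight α v e₂))
                        (interchange (nonzero b) (coordDist b a) (weight v) (dist v α))

¬covers⇒weight : ∀ {m q} (α v : Vertex m (suc q)) → coversᵇ α v ≡ false → weight α < weight v + dist v α
¬covers⇒weight []      []      ()
¬covers⇒weight (a ∷ α) (b ∷ v) e with coordCovers b a in e₁ | e
... | false | _  = ≤-trans (+-mono-<-≤ (coordCovers-false b a e₁) (weight-triangle v α))
                           (≤-reflexive (interchange (nonzero b) (coordDist b a) (weight v) (dist v α)))
... | true  | e₂ = ≤-trans (+-mono-≤-< (≤-reflexive (coordCovers-true b a e₁)) (¬covers⇒weight α v e₂))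
                           (≤-reflexive (interchange (nonzero b) (coordDist b a) (weight v) (dist v α)))

covers≡ : ∀ {m q} (α v : Vertex m (suc q)) → coversᵇ α v ≡ (weight α ≡ᵇ weight v + dist v α)
covers≡ α v with coversᵇ α v in e
... | true  = sym (≡ᵇ-complete (covers⇒weight α v e))
... | false = sym (≡ᵇ-false (λ eq → <-irrefl eq (¬covers⇒weight α v e)))

-- Automorphisms are isometries, so neighbour transitivity gives regularity

coordDist-perm : ∀ {q} (p : Permutation′ q) (a b : Fin q) → coordDist (p ⟨$⟩ʳ a) (p ⟨$⟩ʳ b) ≡ coordDist a b
coordDist-perm p = coordDist-injective (p ⟨$⟩ʳ_) injective
  where
  injective : ∀ {a b} → p ⟨$⟩ʳ a ≡ p ⟨$⟩ʳ b → a ≡ b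
  injective e = trans (sym (inverseˡ p)) (trans (cong (p ⟨$⟩ˡ_) e) (inverseˡ p))

act-isometry : ∀ {m q} (x : Aut m q) (u v : Vertex m q) → dist (act x u) (act x v) ≡ dist u v
act-isometry {m} (h , σ) u v = begin
  dist (act (h , σ) u) (act (h , σ) v)
    ≡⟨ dist≡∑ (act (h , σ) u) (act (h , σ) v) ⟩
  ∑ (allFin m) (λ i → coordDist (lookup (act (h , σ) u) i) (lookup (act (h , σ) v) i))
    ≡⟨ ∑-cong (allFin m) (λ i → cong₂ coordDist (lookup∘tabulate _ i) (lookup∘tabulate _ i)) ⟩
  ∑ (allFin m) (λ i → coordDist (h i ⟨$⟩ʳ lookup u (σ ⟨$⟩ˡ i)) (h i ⟨$⟩ʳ lookup v (σ ⟨$⟩ˡ i)))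
    ≡⟨ ∑-cong (allFin m) (λ i → coordDist-perm (h i) _ _) ⟩
  ∑ (allFin m) (λ i → coordDist (lookup u (σ ⟨$⟩ˡ i)) (lookup v (σ ⟨$⟩ˡ i)))
    ≡⟨ FinSum.∑-reindex (σ ⟨$⟩ˡ_) (σ ⟨$⟩ʳ_) (λ _ → inverseʳ σ) (λ _ → inverseˡ σ)
                        (λ i → coordDist (lookup u i) (lookup v i)) ⟩
  ∑ (allFin m) (λ i → coordDist (lookup u i) (lookup v i))
    ≡⟨ sym (dist≡∑ u v) ⟩
  dist u v ∎

subgroup-inverse : ∀ {m q} (X : Aut m q → Set) → IsSubgroup X → ∀ x → X x →
  Σ (Aut m q) λ z → (∀ ν → act z (act x ν) ≡ ν) × (∀ ν → act x (act z ν) ≡ ν)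
subgroup-inverse X (_ , _ , inv) x Xx with inv x Xx
... | z , Xz , zx with inv z Xz
... | z′ , _ , z′z = z , zx , xz
  where
  xz : ∀ ν → act x (act z ν) ≡ ν
  xz ν = begin
    act x (act z ν)                  ≡⟨ sym (z′z (act x (act z ν))) ⟩
    act z′ (act z (act x (act z ν))) ≡⟨ cong (act z′) (zx (act z ν)) ⟩
    act z′ (act z ν)                 ≡⟨ z′z ν ⟩
    ν                                ∎

countΓ-invariant : ∀ {m q} (C : Code m q) (f g : Vertex m q → Vertex m q)
  → (∀ a → g (f a) ≡ a) → (∀ b → f (g b) ≡ b)
  → (∀ a b → dist (f a) (f b) ≡ dist a b) → (∀ a → C (f a) ≡ C a)
  → ∀ ν k → countΓ C (f ν) k ≡ countΓ C ν k
countΓ-invariant C f g gf fg isometry preserves ν k =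
  trans (sym (card-reindex f g gf fg (λ α → (dist (f ν) α ≡ᵇ k) ∧ C α)))
        (card-cong (λ a → cong₂ _∧_ (cong (_≡ᵇ k) (isometry ν a)) (preserves a)))

neighbourTransitive⇒regular : ∀ {m q} (C : Code m q) (X : Aut m q → Set) (s : ℕ)
  → IsSubgroup X → (∀ x → X x → Stabilises C x) → NeighbourTransitive C X s
  → ∀ i → i ≤ s → ∀ ν ν′ → InC C i ν → InC C i ν′ → ∀ k → countΓ C ν k ≡ countΓ C ν′ k
neighbourTransitive⇒regular C X s subgroup stabilises (_ , transitive) i i≤s ν ν′ ν∈Cᵢ ν′∈Cᵢ k
  with transitive i i≤s ν ν′ ν∈Cᵢ ν′∈Cᵢ
... | x , Xx , refl with subgroup-inverse X subgroup x Xx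
... | z , zx , xz = sym (countΓ-invariant C (act x) (act z) zx xz (act-isometry x) (stabilises x Xx) ν k)

-- Isometries fixing 𝟎 act transitively on each weight class

record ZeroIsometry (m q : ℕ) : Set where
  field
    to from    : Vertex m (suc q) → Vertex m (suc q)
    from-to    : ∀ a → from (to a) ≡ a
    to-from    : ∀ b → to (from b) ≡ b
    isometry   : ∀ a b → dist (to a) (to b) ≡ dist a b
    fixes-zero : to (zeroVec m) ≡ zeroVec m

open ZeroIsometry

preserves-weight : ∀ {m q} (G : ZeroIsometry m q) a → weight (to G a) ≡ weight a
preserves-weight {m} G a = begin
  weight (to G a)                  ≡⟨ weight≡dist (to G a) ⟩
  dist (zeroVec m) (to G a)        ≡⟨ cong (λ z → dist z (to G a)) (sym (fixes-zero G)) ⟩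
  dist (to G (zeroVec m)) (to G a) ≡⟨ isometry G (zeroVec m) a ⟩
  dist (zeroVec m) a               ≡⟨ sym (weight≡dist a) ⟩
  weight a                         ∎

preserves-covers : ∀ {m q} (G : ZeroIsometry m q) a b → coversᵇ (to G a) (to G b) ≡ coversᵇ a b
preserves-covers G a b = begin
  coversᵇ (to G a) (to G b)                                       ≡⟨ covers≡ (to G a) (to G b) ⟩
  (weight (to G a) ≡ᵇ weight (to G b) + dist (to G b) (to G a))   ≡⟨ cong₂ _≡ᵇ_ (preserves-weight G a)
                                                                      (cong₂ _+_ (preserves-weight G b) (isometry G b a)) ⟩
  (weight a ≡ᵇ weight b + dist b a)                               ≡⟨ sym (covers≡ a b) ⟩
  coversᵇ a b                                                     ∎

identityᶻ : ∀ {m q} → ZeroIsometry m q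
identityᶻ = record { to = id ; from = id ; from-to = λ _ → refl ; to-from = λ _ → refl
                   ; isometry = λ _ _ → refl ; fixes-zero = refl }

inverseᶻ : ∀ {m q} → ZeroIsometry m q → ZeroIsometry m q
inverseᶻ {m} G = record
  { to = from G ; from = to G ; from-to = to-from G ; to-from = from-to G
  ; isometry   = λ a b → trans (sym (isometry G (from G a) (from G b))) (cong₂ dist (to-from G a) (to-from G b))
  ; fixes-zero = trans (cong (from G) (sym (fixes-zero G))) (from-to G (zeroVec m)) }

-- G ∘ᶻ H applies H first
_∘ᶻ_ : ∀ {m q} → ZeroIsometry m q → ZeroIsometry m q → ZeroIsometry m q
G ∘ᶻ H = record
  { to = to G ∘ to H ; from = from H ∘ from G
  ; from-to    = λ a → trans (cong (from H) (from-to G (to H a))) (from-to H a)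
  ; to-from    = λ b → trans (cong (to G) (to-from H (from G b))) (to-from G b)
  ; isometry   = λ a b → trans (isometry G (to H a) (to H b)) (isometry H a b)
  ; fixes-zero = trans (cong (to G) (fixes-zero H)) (fixes-zero G) }

liftᶻ : ∀ {m q} → ZeroIsometry m q → ZeroIsometry (suc m) q
liftᶻ G = record
  { to = λ { (a ∷ v) → a ∷ to G v } ; from = λ { (a ∷ v) → a ∷ from G v }
  ; from-to    = λ { (a ∷ v) → cong (a ∷_) (from-to G v) }
  ; to-from    = λ { (a ∷ v) → cong (a ∷_) (to-from G v) }
  ; isometry   = λ { (a ∷ u) (b ∷ v) → cong (coordDist a b +_) (isometry G u v) }
  ; fixes-zero = cong (Fin.zero ∷_) (fixes-zero G) }

relabelFirst : ∀ {m q} (p : Permutation′ (suc q)) → p ⟨$⟩ʳ Fin.zero ≡ Fin.zero → ZeroIsometry (suc m) q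
relabelFirst p p0≡0 = record
  { to = λ { (c ∷ v) → (p ⟨$⟩ʳ c) ∷ v } ; from = λ { (c ∷ v) → (p ⟨$⟩ˡ c) ∷ v }
  ; from-to    = λ { (c ∷ v) → cong (_∷ v) (inverseˡ p) }
  ; to-from    = λ { (c ∷ v) → cong (_∷ v) (inverseʳ p) }
  ; isometry   = λ { (c ∷ u) (c′ ∷ v) → cong (_+ dist u v) (coordDist-perm p c c′) }
  ; fixes-zero = cong (_∷ zeroVec _) p0≡0 }

swap₀₁ : ∀ {m q} → ZeroIsometry (suc (suc m)) q
swap₀₁ = record
  { to = exchange ; from = exchange
  ; from-to    = λ { (a ∷ b ∷ v) → refl }
  ; to-from    = λ { (a ∷ b ∷ v) → refl }
  ; isometry   = λ { (a ∷ b ∷ u) (a′ ∷ b′ ∷ v) → x∙yz≈y∙xz (coordDist b b′) (coordDist a a′) (dist u v) }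
  ; fixes-zero = refl }
  where
  exchange : ∀ {m q} → Vertex (suc (suc m)) q → Vertex (suc (suc m)) q
  exchange (a ∷ b ∷ v) = b ∷ a ∷ v

transpose-here : ∀ {n} (i j : Fin n) → Perm.transpose i j ⟨$⟩ʳ i ≡ j
transpose-here i j with i Fin.≟ i
... | yes _  = refl
... | no i≢i = ⊥-elim (i≢i refl)

nonzeroFirst : ∀ {m q} (v : Vertex (suc m) (suc q)) → 1 ≤ weight v
  → Σ (ZeroIsometry (suc m) q) λ G → Σ (Fin q) λ c → Σ (Vertex m (suc q)) λ w → to G v ≡ Fin.suc c ∷ w
nonzeroFirst (Fin.suc c ∷ w) _ = identityᶻ , c , w , refl
nonzeroFirst {zero}  (Fin.zero ∷ []) ()
nonzeroFirst {suc m} (Fin.zero ∷ v) 1≤wt with nonzeroFirst v 1≤wt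
... | G , c , w , Gv≡ = swap₀₁ ∘ᶻ liftᶻ G , c , Fin.zero ∷ w , cong (λ y → to swap₀₁ (Fin.zero ∷ y)) Gv≡

-- any two vertices of the same weight are related by an isometry fixing 𝟎: for
-- positive weight, bring non-zero entries of both to the front, match the tails
-- recursively and the first entries by a transposition of symbols
transitive-on-weight : ∀ {q} m (u u′ : Vertex m (suc q)) → weight u ≡ weight u′
  → Σ (ZeroIsometry m q) λ G → to G u′ ≡ u
transitive-on-weight zero    []  []   _  = identityᶻ , refl
transitive-on-weight (suc m) u   u′   eq with weight u in wu
... | zero  = identityᶻ , trans (weight≡0 u′ (sym eq)) (sym (weight≡0 u wu))
... | suc n with nonzeroFirst u (≤-trans (s≤s z≤n) (≤-reflexive (sym wu)))
               | nonzeroFirst u′ (≤-trans (s≤s z≤n) (≤-reflexive eq))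
...   | G , c , w , Gu≡ | G′ , c′ , w′ , G′u′≡ with transitive-on-weight m w w′ tails
  where
  tails : weight w ≡ weight w′
  tails = suc-injective (begin
    weight (Fin.suc c ∷ w)   ≡⟨ cong weight (sym Gu≡) ⟩
    weight (to G u)          ≡⟨ trans (preserves-weight G u) wu ⟩
    suc n                    ≡⟨ trans eq (sym (preserves-weight G′ u′)) ⟩
    weight (to G′ u′)        ≡⟨ cong weight G′u′≡ ⟩
    weight (Fin.suc c′ ∷ w′) ∎)
...     | H , Hw′≡w = inverseᶻ G ∘ᶻ (K ∘ᶻ G′) , (begin
    from G (to K (to G′ u′))        ≡⟨ cong (from G ∘ to K) G′u′≡ ⟩
    from G (to K (Fin.suc c′ ∷ w′)) ≡⟨ cong (from G) (cong₂ _∷_ (transpose-here (Fin.suc c′) (Fin.suc c)) Hw′≡w) ⟩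
    from G (Fin.suc c ∷ w)          ≡⟨ cong (from G) (sym Gu≡) ⟩
    from G (to G u)                 ≡⟨ from-to G u ⟩
    u                               ∎)
  where
  K : ZeroIsometry (suc m) _
  K = relabelFirst (Perm.transpose (Fin.suc c′) (Fin.suc c)) refl ∘ᶻ liftᶻ H

-- Restriction to the support of a vertex

restrict : ∀ {m q} → Vertex m (suc q) → Vertex m (suc q) → Vertex m (suc q)
restrict []              []      = []
restrict (Fin.zero  ∷ u) (b ∷ α) = Fin.zero ∷ restrict u α
restrict (Fin.suc _ ∷ u) (b ∷ α) = b ∷ restrict u α

restrict-idempotent : ∀ {m q} (u α : Vertex m (suc q)) → restrict u (restrict u α) ≡ restrict u α
restrict-idempotent []              []      = refl
restrict-idempotent (Fin.zero  ∷ u) (b ∷ α) = cong (Fin.zero ∷_) (restrict-idempotent u α)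
restrict-idempotent (Fin.suc _ ∷ u) (b ∷ α) = cong (b ∷_) (restrict-idempotent u α)

restrict-dist : ∀ {m q} (u α : Vertex m (suc q))
  → dist u α + weight (restrict u α) ≡ dist u (restrict u α) + weight α
restrict-dist []              []      = refl
restrict-dist (Fin.zero ∷ u) (b ∷ α) = begin
  (coordDist Fin.zero b + dist u α) + weight (restrict u α) ≡⟨ +-assoc (coordDist Fin.zero b) _ _ ⟩
  coordDist Fin.zero b + (dist u α + weight (restrict u α)) ≡⟨ cong₂ _+_ (sym (nonzero≡coordDist b)) (restrict-dist u α) ⟩
  nonzero b + (dist u (restrict u α) + weight α)            ≡⟨ x∙yz≈y∙xz (nonzero b) (dist u (restrict u α)) (weight α) ⟩
  dist u (restrict u α) + (nonzero b + weight α)            ∎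
restrict-dist (Fin.suc a ∷ u) (b ∷ α) = begin
  (x + dist u α) + (nonzero b + weight (restrict u α)) ≡⟨ interchange x _ _ _ ⟩
  (x + nonzero b) + (dist u α + weight (restrict u α)) ≡⟨ cong ((x + nonzero b) +_) (restrict-dist u α) ⟩
  (x + nonzero b) + (dist u (restrict u α) + weight α) ≡⟨ interchange x _ _ _ ⟩
  (x + dist u (restrict u α)) + (nonzero b + weight α) ∎
  where
  x : ℕ
  x = coordDist (Fin.suc a) b

Supported : ∀ {m q} → Vertex m (suc q) → Vertex m (suc q) → Set
Supported u r = restrict u r ≡ r

covers-restrict : ∀ {m q} (u r α : Vertex m (suc q)) → Supported u r → coversᵇ α r ≡ coversᵇ (restrict u α) r
covers-restrict []              []      []      _ = refl
covers-restrict (Fin.zero  ∷ u) (c ∷ r) (b ∷ α) s with ∷-injective s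
... | refl , s′ = covers-restrict u r α s′
covers-restrict (Fin.suc _ ∷ u) (c ∷ r) (b ∷ α) s =
  cong (coordCovers c b ∧_) (covers-restrict u r α (∷-injectiveʳ s))

supported-weight : ∀ {m q} (u r : Vertex m (suc q)) → Supported u r → weight r ≤ weight u
supported-weight []              []      _ = z≤n
supported-weight (Fin.zero  ∷ u) (c ∷ r) s with ∷-injective s
... | refl , s′ = supported-weight u r s′
supported-weight (Fin.suc _ ∷ u) (c ∷ r) s = +-mono-≤ (nonzero≤1 c) (supported-weight u r (∷-injectiveʳ s))

-- Cover counts determine distance counts

coverCount : ∀ {m q} → (Vertex m q → Bool) → Vertex m q → ℕ
coverCount D r = card (λ α → D α ∧ coversᵇ α r)

distCount : ∀ {m q} → Vertex m q → (Vertex m q → Bool) → ℕ → ℕ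
distCount u D d = card (λ α → (dist u α ≡ᵇ d) ∧ D α)

covers-refl : ∀ {m q} (r : Vertex m (suc q)) → coversᵇ r r ≡ true
covers-refl r = trans (covers≡ r r) (≡ᵇ-complete (sym (trans (cong (weight r +_) (dist-refl r)) (+-identityʳ (weight r)))))

covers-heavier : ∀ {m q} (r r′ : Vertex m (suc q)) → coversᵇ r′ r ≡ true → r′ ≢ r → weight r < weight r′
covers-heavier r r′ cov r′≢r =
  <-≤-trans (m<m+n (weight r) (n≢0⇒n>0 (r′≢r ∘ sym ∘ dist≡0 r r′))) (≤-reflexive (sym (covers⇒weight r′ r cov)))

module SupportInversion {m q : ℕ} (u : Vertex m (suc q)) where

  private
    L : List (Vertex m (suc q))
    L = allVertices m (suc q)
    open VertexSum {m} {suc q} using (δ; ∑-fibres; ∑-pin)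

  fibre : (Vertex m (suc q) → Bool) → Vertex m (suc q) → ℕ
  fibre D r = ∑ L (λ α → δ r (restrict u α) * 𝟙 (D α))

  fibre-unsupported : ∀ D r → ¬ Supported u r → fibre D r ≡ 0
  fibre-unsupported D r unsupported = trans (∑-cong L term) (∑-zero L)
    where
    term : ∀ α → δ r (restrict u α) * 𝟙 (D α) ≡ 0
    term α with r ≟ᵛ restrict u α
    ... | yes refl = ⊥-elim (unsupported (restrict-idempotent u α))
    ... | no _     = refl

  coverCount≡∑fibres : ∀ D r → Supported u r → coverCount D r ≡ ∑ L (λ r′ → 𝟙 (coversᵇ r′ r) * fibre D r′)
  coverCount≡∑fibres D r supported = begin
    coverCount D r                                         ≡⟨ card≡∑ {m} {suc q} _ ⟩
    ∑ L (λ α → 𝟙 (D α ∧ coversᵇ α r))                      ≡⟨ ∑-cong L term ⟩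
    ∑ L (λ α → 𝟙 (D α) * 𝟙 (coversᵇ (restrict u α) r))     ≡⟨ ∑-fibres (restrict u) (𝟙 ∘ D) (λ r′ → 𝟙 (coversᵇ r′ r)) ⟩
    ∑ L (λ r′ → 𝟙 (coversᵇ r′ r) * fibre D r′)             ∎
    where
    term : ∀ α → 𝟙 (D α ∧ coversᵇ α r) ≡ 𝟙 (D α) * 𝟙 (coversᵇ (restrict u α) r)
    term α = trans (𝟙-∧ (D α) _) (cong (λ c → 𝟙 (D α) * 𝟙 c) (covers-restrict u r α supported))

  distCount≡∑fibres : ∀ D w → (∀ α → D α ≡ true → weight α ≡ w) → ∀ d
    → distCount u D d ≡ ∑ L (λ r → 𝟙 (dist u r + w ≡ᵇ d + weight r) * fibre D r)
  distCount≡∑fibres D w weight-w d = begin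
    distCount u D d                                  ≡⟨ card≡∑ {m} {suc q} _ ⟩
    ∑ L (λ α → 𝟙 ((dist u α ≡ᵇ d) ∧ D α))            ≡⟨ ∑-cong L term ⟩
    ∑ L (λ α → 𝟙 (D α) * test (restrict u α))        ≡⟨ ∑-fibres (restrict u) (𝟙 ∘ D) test ⟩
    ∑ L (λ r → test r * fibre D r)                   ∎
    where
    test : Vertex m (suc q) → ℕ
    test r = 𝟙 (dist u r + w ≡ᵇ d + weight r)
    term : ∀ α → 𝟙 ((dist u α ≡ᵇ d) ∧ D α) ≡ 𝟙 (D α) * test (restrict u α)
    term α with D α in α∈D
    ... | false = cong 𝟙 (∧-zeroʳ (dist u α ≡ᵇ d))
    ... | true  = trans (cong 𝟙 (∧-identityʳ _)) (sym (trans (+-identityʳ _) (cong 𝟙 (≡ᵇ-⇔ backward forward))))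
      where
      shift : dist u α + weight (restrict u α) ≡ dist u (restrict u α) + w
      shift = trans (restrict-dist u α) (cong (dist u (restrict u α) +_) (weight-w α α∈D))
      forward : dist u α ≡ d → dist u (restrict u α) + w ≡ d + weight (restrict u α)
      forward e = trans (sym shift) (cong (_+ weight (restrict u α)) e)
      backward : dist u (restrict u α) + w ≡ d + weight (restrict u α) → dist u α ≡ d
      backward e = +-cancelʳ-≡ (weight (restrict u α)) _ _ (trans shift e)

  -- cover counts on the support of u determine the fibres (downward induction on weight)
  fibres-agree : ∀ D D′ → (∀ r → Supported u r → coverCount D r ≡ coverCount D′ r)
    → ∀ n r → m ∸ weight r < n → fibre D r ≡ fibre D′ r
  fibres-agree D D′ agree (suc n) r (s≤s bound) with restrict u r ≟ᵛ r
  ... | no unsupported = trans (fibre-unsupported D r unsupported) (sym (fibre-unsupported D′ r unsupported))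
  ... | yes supported = begin
    fibre D r                       ≡⟨ sym (*-identityˡ (fibre D r)) ⟩
    1 * fibre D r                   ≡⟨ subst (λ c → 𝟙 c * fibre D r ≡ 𝟙 c * fibre D′ r) (covers-refl r) at-r ⟩
    1 * fibre D′ r                  ≡⟨ *-identityˡ (fibre D′ r) ⟩
    fibre D′ r                      ∎
    where
    h : (Vertex m (suc q) → Bool) → Vertex m (suc q) → ℕ
    h E r′ = 𝟙 (coversᵇ r′ r) * fibre E r′
    off-r : ∀ r′ → r′ ≢ r → h D r′ ≡ h D′ r′
    off-r r′ r′≢r with coversᵇ r′ r in cov
    ... | false = refl
    ... | true  = cong (_+ 0) (fibres-agree D D′ agree n r′
                    (<-≤-trans (∸-monoʳ-< (covers-heavier r r′ cov r′≢r) (weight≤length r′)) bound))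
    at-r : h D r ≡ h D′ r
    at-r = ∑-pin r (h D) (h D′)
             (trans (sym (coverCount≡∑fibres D r supported)) (trans (agree r supported) (coverCount≡∑fibres D′ r supported)))
             off-r

  distCounts-agree : ∀ D D′ w → (∀ α → D α ≡ true → weight α ≡ w) → (∀ α → D′ α ≡ true → weight α ≡ w)
    → (∀ r → Supported u r → coverCount D r ≡ coverCount D′ r) → ∀ d → distCount u D d ≡ distCount u D′ d
  distCounts-agree D D′ w weight-w weight-w′ agree d = begin
    distCount u D d
      ≡⟨ distCount≡∑fibres D w weight-w d ⟩
    ∑ L (λ r → 𝟙 (dist u r + w ≡ᵇ d + weight r) * fibre D r)
      ≡⟨ ∑-cong L (λ r → cong (𝟙 (dist u r + w ≡ᵇ d + weight r) *_)
                             (fibres-agree D D′ agree (suc (m ∸ weight r)) r ≤-refl)) ⟩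
    ∑ L (λ r → 𝟙 (dist u r + w ≡ᵇ d + weight r) * fibre D′ r)
      ≡⟨ sym (distCount≡∑fibres D′ w weight-w′ d) ⟩
    distCount u D′ d ∎

image : ∀ {m q} → ZeroIsometry m q → (Vertex m (suc q) → Bool) → Vertex m (suc q) → Bool
image G D = D ∘ from G

image-distCount : ∀ {m q} (G : ZeroIsometry m q) D u d → distCount (to G u) (image G D) d ≡ distCount u D d
image-distCount G D u d = trans (sym (card-reindex (to G) (from G) (from-to G) (to-from G) _))
  (card-cong (λ α → cong₂ _∧_ (cong (_≡ᵇ d) (isometry G u α)) (cong D (from-to G α))))

image-coverCount : ∀ {m q} (G : ZeroIsometry m q) D r → coverCount (image G D) (to G r) ≡ coverCount D r
image-coverCount G D r = trans (sym (card-reindex (to G) (from G) (from-to G) (to-from G) _))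
  (card-cong (λ α → cong₂ _∧_ (cong D (from-to G α)) (preserves-covers G α r)))

CoverRegular : ∀ {m q} → (Vertex m q → Bool) → ℕ → Set
CoverRegular D t = ∀ r r′ → weight r ≡ weight r′ → weight r ≤ t → coverCount D r ≡ coverCount D r′

distCounts-uniform : ∀ {m q} (D : Vertex m (suc q) → Bool) w t
  → (∀ α → D α ≡ true → weight α ≡ w) → CoverRegular D t
  → ∀ u u′ → weight u ≡ weight u′ → weight u ≤ t → ∀ d → distCount u D d ≡ distCount u′ D d
distCounts-uniform {m} D w t weight-w regular u u′ same u≤t d
  with transitive-on-weight m u u′ same
... | G , Gu′≡u = begin
  distCount u D d                  ≡⟨ SupportInversion.distCounts-agree u D (image G D) w weight-w weight-image agree d ⟩
  distCount u (image G D) d        ≡⟨ cong (λ v → distCount v (image G D) d) (sym Gu′≡u) ⟩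
  distCount (to G u′) (image G D) d ≡⟨ image-distCount G D u′ d ⟩
  distCount u′ D d                 ∎
  where
  weight-image : ∀ β → image G D β ≡ true → weight β ≡ w
  weight-image β β∈ = trans (sym (preserves-weight (inverseᶻ G) β)) (weight-w (from G β) β∈)
  agree : ∀ r → Supported u r → coverCount D r ≡ coverCount (image G D) r
  agree r supported = begin
    coverCount D r                        ≡⟨ regular r (from G r) (sym (preserves-weight (inverseᶻ G) r))
                                               (≤-trans (supported-weight u r supported) u≤t) ⟩
    coverCount D (from G r)               ≡⟨ sym (image-coverCount G D (from G r)) ⟩
    coverCount (image G D) (to G (from G r)) ≡⟨ cong (coverCount (image G D)) (to-from G r) ⟩
    coverCount (image G D) r              ∎

-- Weight slices of a code
--
-- Splitting the codewords at distance d from v by weight: the slices of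
-- weight w > weight v + d contribute nothing, and for d = w ∸ weight v
-- the slice of weight w contributes exactly the codewords covering v.

slice-weight : ∀ {m q} (C : Code m q) w α → weightSlice C w α ≡ true → weight α ≡ w
slice-weight C w α e with C α
... | true = ≡ᵇ-sound e

<ᵇ-suc : ∀ x n → 𝟙 (x <ᵇ suc n) ≡ 𝟙 (x <ᵇ n) + 𝟙 (x ≡ᵇ n)
<ᵇ-suc zero    zero    = refl
<ᵇ-suc zero    (suc n) = refl
<ᵇ-suc (suc x) zero    = refl
<ᵇ-suc (suc x) (suc n) = <ᵇ-suc x n

module WeightSlices {m q : ℕ} (C : Code m (suc q)) where

  private
    V : Set
    V = Vertex m (suc q)

  countBelow : V → ℕ → ℕ → ℕ
  countBelow v d n = card (λ α → ((dist v α ≡ᵇ d) ∧ C α) ∧ (weight α <ᵇ n))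

  countBelow-zero : ∀ v d → countBelow v d 0 ≡ 0
  countBelow-zero v d = card-empty (λ α → ((dist v α ≡ᵇ d) ∧ C α) ∧ (weight α <ᵇ 0)) (λ α → ∧-zeroʳ _)

  countBelow-suc : ∀ v d n → countBelow v d (suc n) ≡ countBelow v d n + distCount v (weightSlice C n) d
  countBelow-suc v d n = begin
    countBelow v d (suc n)                                   ≡⟨ card≡∑ {m} {suc q} _ ⟩
    ∑ L (λ α → 𝟙 (((dist v α ≡ᵇ d) ∧ C α) ∧ (weight α <ᵇ suc n)))   ≡⟨ ∑-cong L term ⟩
    ∑ L (λ α → 𝟙 (((dist v α ≡ᵇ d) ∧ C α) ∧ (weight α <ᵇ n)) + 𝟙 ((dist v α ≡ᵇ d) ∧ weightSlice C n α))
                                                             ≡⟨ ∑-+ L _ _ ⟩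
    ∑ L (λ α → 𝟙 (((dist v α ≡ᵇ d) ∧ C α) ∧ (weight α <ᵇ n))) + ∑ L (λ α → 𝟙 ((dist v α ≡ᵇ d) ∧ weightSlice C n α))
                                                             ≡⟨ sym (cong₂ _+_ (card≡∑ {m} {suc q} _) (card≡∑ {m} {suc q} _)) ⟩
    countBelow v d n + distCount v (weightSlice C n) d       ∎
    where
    L : List V
    L = allVertices m (suc q)
    term : ∀ α → 𝟙 (((dist v α ≡ᵇ d) ∧ C α) ∧ (weight α <ᵇ suc n))
               ≡ 𝟙 (((dist v α ≡ᵇ d) ∧ C α) ∧ (weight α <ᵇ n)) + 𝟙 ((dist v α ≡ᵇ d) ∧ weightSlice C n α)
    term α with dist v α ≡ᵇ d | C α
    ... | false | _     = refl
    ... | true  | false = refl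
    ... | true  | true  = <ᵇ-suc (weight α) n

  -- a codeword at distance d from v has weight at most weight v + d
  countBelow-all : ∀ v d n → weight v + d ≤ n → countBelow v d (suc n) ≡ countΓ C v d
  countBelow-all v d n bound = card-cong term
    where
    term : ∀ α → ((dist v α ≡ᵇ d) ∧ C α) ∧ (weight α <ᵇ suc n) ≡ (dist v α ≡ᵇ d) ∧ C α
    term α with dist v α ≡ᵇ d in at-d | C α
    ... | false | _     = refl
    ... | true  | false = refl
    ... | true  | true  = Equivalence.to T-≡ (<⇒<ᵇ (s≤s (≤-trans (weight-triangle v α)
      (≤-trans (≤-reflexive (cong (weight v +_) (≡ᵇ-sound at-d))) bound))))

  countBelow-agree : ∀ v v′ d n → (∀ w → w < n → distCount v (weightSlice C w) d ≡ distCount v′ (weightSlice C w) d)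
    → countBelow v d n ≡ countBelow v′ d n
  countBelow-agree v v′ d zero    _     = trans (countBelow-zero v d) (sym (countBelow-zero v′ d))
  countBelow-agree v v′ d (suc n) agree = begin
    countBelow v d (suc n)                                   ≡⟨ countBelow-suc v d n ⟩
    countBelow v d n + distCount v (weightSlice C n) d       ≡⟨ cong₂ _+_ (countBelow-agree v v′ d n (λ w w<n → agree w (m<n⇒m<1+n w<n)))
                                                                           (agree n ≤-refl) ⟩
    countBelow v′ d n + distCount v′ (weightSlice C n) d     ≡⟨ sym (countBelow-suc v′ d n) ⟩
    countBelow v′ d (suc n)                                  ∎

  distCount-top : ∀ v w → weight v ≤ w → distCount v (weightSlice C w) (w ∸ weight v) ≡ coverCount (weightSlice C w) v
  distCount-top v w v≤w = card-cong term
    where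
    term : ∀ α → (dist v α ≡ᵇ (w ∸ weight v)) ∧ weightSlice C w α ≡ weightSlice C w α ∧ coversᵇ α v
    term α with weightSlice C w α in α∈
    ... | false = ∧-zeroʳ _
    ... | true  = trans (∧-identityʳ _) (trans (≡ᵇ-⇔ forward backward) (sym (covers≡ α v)))
      where
      forward : dist v α ≡ w ∸ weight v → weight α ≡ weight v + dist v α
      forward e = trans (slice-weight C w α α∈) (trans (sym (m+[n∸m]≡n v≤w)) (cong (weight v +_) (sym e)))
      backward : weight α ≡ weight v + dist v α → dist v α ≡ w ∸ weight v
      backward e = trans (sym (m+n∸m≡n (weight v) (dist v α))) (cong (_∸ weight v) (trans (sym e) (slice-weight C w α α∈)))

  coverCount-light : ∀ v w → w < weight v → coverCount (weightSlice C w) v ≡ 0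
  coverCount-light v w w<v = card-empty _ term
    where
    term : ∀ α → weightSlice C w α ∧ coversᵇ α v ≡ false
    term α with weightSlice C w α in α∈ | coversᵇ α v in cov
    ... | false | _     = refl
    ... | true  | false = refl
    ... | true  | true  = ⊥-elim (<⇒≱ w<v (≤-trans (m≤m+n (weight v) (dist v α))
      (≤-reflexive (trans (sym (covers⇒weight α v cov)) (slice-weight C w α α∈)))))

  countΓ-split : ∀ v w → weight v ≤ w
    → countΓ C v (w ∸ weight v) ≡ countBelow v (w ∸ weight v) w + coverCount (weightSlice C w) v
  countΓ-split v w v≤w = begin
    countΓ C v d                                          ≡⟨ sym (countBelow-all v d w (≤-reflexive (m+[n∸m]≡n v≤w))) ⟩
    countBelow v d (suc w)                                ≡⟨ countBelow-suc v d w ⟩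
    countBelow v d w + distCount v (weightSlice C w) d    ≡⟨ cong (countBelow v d w +_) (distCount-top v w v≤w) ⟩
    countBelow v d w + coverCount (weightSlice C w) v     ∎
    where
    d : ℕ
    d = w ∸ weight v

  slices-coverRegular : ∀ s → (∀ v v′ → weight v ≡ weight v′ → weight v ≤ s → ∀ k → countΓ C v k ≡ countΓ C v′ k)
    → ∀ w → CoverRegular (weightSlice C w) s
  slices-coverRegular s uniform = <-rec (λ w → CoverRegular (weightSlice C w) s) step
    where
    step : ∀ w → (∀ {w′} → w′ < w → CoverRegular (weightSlice C w′) s) → CoverRegular (weightSlice C w) s
    step w lighter v v′ same v≤s with weight v ≤? w
    ... | no  v≰w = trans (coverCount-light v w (≰⇒> v≰w)) (sym (coverCount-light v′ w (≰⇒> (v≰w ∘ subst (_≤ w) (sym same)))))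
    ... | yes v≤w = +-cancelˡ-≡ (countBelow v d w) _ _ (begin
      countBelow v d w + coverCount (weightSlice C w) v   ≡⟨ sym (countΓ-split v w v≤w) ⟩
      countΓ C v d                                        ≡⟨ uniform v v′ same v≤s d ⟩
      countΓ C v′ d                                       ≡⟨ subst (λ t → countΓ C v′ (w ∸ t) ≡ countBelow v′ (w ∸ t) w + coverCount (weightSlice C w) v′)
                                                                  (sym same) (countΓ-split v′ w (subst (_≤ w) same v≤w)) ⟩
      countBelow v′ d w + coverCount (weightSlice C w) v′ ≡⟨ cong (_+ coverCount (weightSlice C w) v′) (sym below-agree) ⟩
      countBelow v d w + coverCount (weightSlice C w) v′  ∎)
      where
      d : ℕ
      d = w ∸ weight v
      below-agree : countBelow v d w ≡ countBelow v′ d w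
      below-agree = countBelow-agree v v′ d w (λ w′ w′<w →
        distCounts-uniform (weightSlice C w′) w′ s (slice-weight C w′) (lighter w′<w) v v′ same v≤s d)

-- with 𝟎 ∈ C and δ ≥ 2s, a vertex v of weight at most s lies in C_{weight v}:
-- 𝟎 is at distance weight v, any other codeword α at distance ≥ 2s - weight v
light∈C : ∀ {m q} (C : Code m (suc q)) s → C (zeroVec m) ≡ true → MinDistAtLeast C (2 * s)
  → ∀ v → weight v ≤ s → InC C (weight v) v
light∈C {m} C s 0∈C δ≥2s v v≤s =
  (zeroVec m , 0∈C , trans (dist-sym v (zeroVec m)) (sym (weight≡dist v))) , nearest
  where
  nearest : ∀ α → C α ≡ true → weight v ≤ dist v α
  nearest α α∈C with α ≟ᵛ zeroVec m
  ... | yes refl = ≤-reflexive (trans (weight≡dist v) (dist-sym (zeroVec m) v))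
  ... | no  α≢0  = +-cancelˡ-≤ (weight v) (weight v) (dist v α)
    (≤-trans (+-mono-≤ v≤s v≤s)
    (≤-trans (≤-reflexive (cong (s +_) (sym (+-identityʳ s))))
    (≤-trans (δ≥2s (zeroVec m) α 0∈C α∈C (α≢0 ∘ sym))
    (≤-trans (dist-triangle (zeroVec m) v α)
             (≤-reflexive (cong (_+ dist v α) (sym (weight≡dist v))))))))

weight-exists : ∀ {q m s} → s ≤ m → Σ (Vertex m (suc (suc q))) (λ v → weight v ≡ s)
weight-exists {m = m} z≤n      = zeroVec m , trans (weight≡dist (zeroVec m)) (dist-refl (zeroVec m))
weight-exists         (s≤s s≤m) with weight-exists s≤m
... | v , weight-v = Fin.suc Fin.zero ∷ v , cong suc weight-v

lemma2p16 : (m q : ℕ) (q≥2 : 2 ≤ q) (C : Code m q) (X : Aut m q → Set) (s : ℕ)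
    → IsSubgroup X
    → (∀ x → X x → Stabilises C x)
    → NeighbourTransitive C X s
    → SRegular C s
      × (C (zeroV m q≥2) ≡ true → MinDistAtLeast C (2 * s)
         → ∀ k → s ≤ k → k ≤ m → Σ ℕ (λ λ' → IsDesign s k λ' (weightSlice C k)))
lemma2p16 m q q≥2@(s≤s (s≤s z≤n)) C X s subgroup stabilises transitive = regular , designs
  where
  by-class : ∀ i → i ≤ s → ∀ ν ν′ → InC C i ν → InC C i ν′ → ∀ k → countΓ C ν k ≡ countΓ C ν′ k
  by-class = neighbourTransitive⇒regular C X s subgroup stabilises transitive

  regular : SRegular C s
  regular = proj₁ transitive , λ i i≤s ν ν′ ν∈ ν′∈ k _ → by-class i i≤s ν ν′ ν∈ ν′∈ k

  designs : C (zeroV m q≥2) ≡ true → MinDistAtLeast C (2 * s)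
    → ∀ k → s ≤ k → k ≤ m → Σ ℕ (λ λ' → IsDesign s k λ' (weightSlice C k))
  designs 0∈C δ≥2s k s≤k k≤m with weight-exists (≤-trans s≤k k≤m)
  ... | e , weight-e = coverCount (weightSlice C k) e , s≤k , slice-weight C k
                     , λ u weight-u → cover-regular u e (trans weight-u (sym weight-e)) (≤-reflexive weight-u)
    where
    by-weight : ∀ v v′ → weight v ≡ weight v′ → weight v ≤ s → ∀ k → countΓ C v k ≡ countΓ C v′ k
    by-weight v v′ same v≤s = by-class (weight v) v≤s v v′ (light∈C C s 0∈C δ≥2s v v≤s)
      (subst (λ t → InC C t v′) (sym same) (light∈C C s 0∈C δ≥2s v′ (subst (_≤ s) same v≤s)))
    cover-regular : CoverRegular (weightSlice C k) s
    cover-regular = WeightSlices.slices-coverRegular C s by-weight k
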